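{- Let $D_0$ be a diagram all of whose cells lie in columns $1,\dots,n$, and let $b_i$ denote the number of cells of $D_0$ in column $i$ for $1\le i\le n$. If $b_1\ge b_2\ge\cdots\ge b_n$, then the Kohnert poset $\mathcal{P}(D_0)$ is bounded.
   Context: A diagram is a finite set $D$ of cells $(r,c)$ with $r,c$ positive integers; $r$ is the row (rows numbered from bottom to top starting at 1) and $c$ the column (numbered from left to right starting at 1). A Kohnert move at row $r$ applied to a diagram $D$: if row $r$ of $D$ is empty, $D$ is unchanged; otherwise let $(r,c)$ be the cell of row $r$ with the largest column index; if every position $(r',c)$ with $1\le r'<r$ belongs to $D$, then $D$ is unchanged; otherwise let $r'$ be the largest integer with $1\le r'<r$ and $(r',c)\notin D$, and the move replaces the cell $(r,c)$ by $(r',c)$. For a diagram $D_0$, $KD(D_0)$ is the set of all diagrams obtainable from $D_0$ by finite (possibly empty) sequences of Kohnert moves. The Kohnert poset $\mathcal{P}(D_0)$ is $KD(D_0)$ ordered by $D_2\preceq D_1$ iff $D_2$ can be obtained from $D_1$ by a finite sequence of Kohnert moves. A finite poset is bounded if it has a unique minimal element and a unique maximal element. -}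

module Defs where

open import Data.Nat using (ℕ; suc; _≤_; _<_; _≟_)
open import Data.Product using (Σ; _×_; _,_; ∃-syntax)
open import Data.Sum using (_⊎_)
open import Data.List using (List; filter; length)
open import Data.List.Membership.Propositional using (_∈_; _∉_)
open import Relation.Binary.PropositionalEquality using (_≡_; _≢_)
open import Relation.Binary.Construct.Closure.ReflexiveTransitive using (Star)
open import Relation.Nullary using (¬_)

-- A cell (r , c): r = row (bottom row is 1), c = column (leftmost is 1).
Cell : Set
Cell = ℕ × ℕ

-- A diagram is a finite set of cells, represented by a list; only membership
-- matters, and two diagrams are equal iff they have the same cells.
Diagram : Set
Diagram = List Cell

_≈_ : Diagram → Diagram → Set
D ≈ E = ∀ x → (x ∈ D → x ∈ E) × (x ∈ E → x ∈ D)

-- A (non-trivial) Kohnert move from D to E: the rightmost cell (r , c) of row r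
-- moves down to (r' , c), where r' is the highest empty position below it in
-- column c.  (Moves leaving D unchanged are absorbed by reflexivity below.)
KohnertMove : Diagram → Diagram → Set
KohnertMove D E =
  Σ ℕ λ r → Σ ℕ λ c → Σ ℕ λ r' →
    ((r , c) ∈ D)
  × (∀ c' → (r , c') ∈ D → c' ≤ c)
  × (1 ≤ r') × (r' < r)
  × ((r' , c) ∉ D)
  × (∀ r'' → r' < r'' → r'' < r → (r'' , c) ∈ D)
  × (∀ x → (x ∈ E → (x ∈ D × x ≢ (r , c)) ⊎ x ≡ (r' , c))
         × ((x ∈ D × x ≢ (r , c)) ⊎ x ≡ (r' , c) → x ∈ E))

Reach : Diagram → Diagram → Set
Reach D E = Σ Diagram λ D' → Star KohnertMove D D' × (D' ≈ E)

-- Elements of KD(D0): diagrams reachable from D0.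
-- Order on P(D0): D2 ⪯ D1 iff Reach D1 D2.
_⪯_ : Diagram → Diagram → Set
D₂ ⪯ D₁ = Reach D₁ D₂

IsMinimal : Diagram → Diagram → Set
IsMinimal D₀ M = Reach D₀ M × (∀ D → Reach D₀ D → D ⪯ M → D ≈ M)

IsMaximal : Diagram → Diagram → Set
IsMaximal D₀ M = Reach D₀ M × (∀ D → Reach D₀ D → M ⪯ D → D ≈ M)

Bounded : Diagram → Set
Bounded D₀ =
    (Σ Diagram λ m → IsMinimal D₀ m × (∀ m' → IsMinimal D₀ m' → m' ≈ m))
  × (Σ Diagram λ M → IsMaximal D₀ M × (∀ M' → IsMaximal D₀ M' → M' ≈ M))

colCount : Diagram → ℕ → ℕ
colCount D i = length (filter (λ x → Data.Product.proj₂ x ≟ i) D)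

{-# OPTIONS --safe #-}
-- Every Kohnert move lowers one cell, so it strictly decreases the sum of the row
-- indices of the cells. Hence nothing reachable from D₀ lies above D₀, and moving
-- while some move applies ends in a diagram where no move applies; such diagrams
-- are exactly the minimal elements. Moves keep the number b c of cells in every
-- column c. In a diagram where no move applies, the rightmost cell (r , c*) of any
-- row r sits on a full column, so r ≤ b c* ≤ b c for every cell (r , c) of that row;
-- counting then shows that column c occupies exactly the rows 1, …, b c. So all such
-- diagrams coincide, and the minimal element is unique.
module Submission where

open import Defs
open import Data.Nat using (ℕ; zero; suc; _+_; _≤_; _<_; _≤′_; ≤′-refl; ≤′-step; z≤n; s≤s; s≤s⁻¹; _≟_; _≤?_)
open import Data.Nat.Properties
open import Data.Nat.Induction using (<-wellFounded)
open import Data.Nat.ListAction using (sum)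
open import Data.Nat.ListAction.Properties using (sum-↭)
open import Data.Product as Product using (Σ; ∃-syntax; _×_; _,_; proj₁; proj₂)
open import Data.Product.Properties using (≡-dec)
open import Data.Sum as Sum using (_⊎_; inj₁; inj₂)
open import Data.List using (List; []; _∷_; filter; length; map; applyUpTo; deduplicate)
open import Data.List.Properties using (filter-notAll; filter-accept; filter-reject; length-applyUpTo)
open import Data.List.Membership.Propositional using (_∈_; _∉_; find; lose)
open import Data.List.Membership.Propositional.Properties
  using (∈-filter⁺; ∈-filter⁻; ∈-applyUpTo⁺; ∈-applyUpTo⁻; ∈-deduplicate⁺; ∈-deduplicate⁻)
open import Data.List.Membership.Propositional.Properties.WithK using (unique∧set⇒bag)
import Data.List.Membership.DecPropositional as DecMembership
open import Data.List.Relation.Unary.Any as Any using (here; there; any?)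
open import Data.List.Relation.Unary.All as All using (All; all?)
open import Data.List.Relation.Unary.Unique.Propositional using (Unique; _∷_)
open import Data.List.Relation.Unary.Unique.Propositional.Properties using (applyUpTo⁺₁; filter⁺)
open import Data.List.Relation.Unary.Unique.DecPropositional.Properties using (deduplicate-!)
open import Data.List.Relation.Binary.Subset.Propositional using (_⊆_)
open import Data.List.Relation.Binary.Permutation.Propositional using (_↭_)
open import Data.List.Relation.Binary.Permutation.Propositional.Properties
  using (↭-length; filter-↭; map⁺)
open import Data.List.Relation.Binary.BagAndSetEquality using (∼bag⇒↭)
open import Data.List.Extrema.Nat using (argmax; argmax-sel; f[⊥]≤f[argmax]; f[xs]≤f[argmax])
open import Function.Base using (_∘_)
open import Function.Bundles using (_⇔_; mk⇔; Equivalence)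
open import Induction.WellFounded using (Acc; acc)
open import Relation.Binary.Definitions using (DecidableEquality)
open import Relation.Binary.PropositionalEquality
open import Relation.Binary.Construct.Closure.ReflexiveTransitive using (Star; ε; _◅_; _◅◅_)
open import Relation.Nullary using (¬_; Dec; yes; no; ¬?; contradiction; map′; _→-dec_)

unique-set⇒↭ : ∀ {A : Set} {xs ys : List A} → Unique xs → Unique ys → (∀ {x} → x ∈ xs ⇔ x ∈ ys) → xs ↭ ys
unique-set⇒↭ uxs uys same = ∼bag⇒↭ (unique∧set⇒bag uxs uys same)

module _ {A : Set} (_≟ᴬ_ : DecidableEquality A) where

  length-<-⊆ : ∀ {xs ys y} → Unique xs → xs ⊆ ys → y ∈ ys → y ∉ xs → length xs < length ys
  length-≤-⊆ : ∀ {xs ys} → Unique xs → xs ⊆ ys → length xs ≤ length ys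

  length-<-⊆ {xs} {ys} {y} uxs xs⊆ys y∈ys y∉xs = begin-strict
    length xs                    ≤⟨ length-≤-⊆ uxs (λ x∈xs → ∈-filter⁺ differs? (xs⊆ys x∈xs) (λ { refl → y∉xs x∈xs })) ⟩
    length (filter differs? ys)  <⟨ filter-notAll differs? ys (Any.map (λ { refl y≢y → y≢y refl }) y∈ys) ⟩
    length ys                    ∎
    where
    open ≤-Reasoning
    differs? : (x : A) → Dec (x ≢ y)
    differs? x = ¬? (x ≟ᴬ y)

  length-≤-⊆ {[]}     _               _     = z≤n
  length-≤-⊆ {x ∷ xs} (x∉xs ∷ uxs) x∷xs⊆ys =
    length-<-⊆ uxs (λ x∈xs → x∷xs⊆ys (there x∈xs)) (x∷xs⊆ys (here refl)) (λ x∈xs → All.lookup x∉xs x∈xs refl)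

_≟ᶜ_ : DecidableEquality Cell
_≟ᶜ_ = ≡-dec _≟_ _≟_

open DecMembership _≟ᶜ_ using (_∈?_)

-- A diagram is a list that may repeat cells; the row sum and the column sizes are
-- measured on its deduplication, so that they only depend on the set of cells.
cells : Diagram → List Cell
cells = deduplicate _≟ᶜ_

cells-unique : ∀ D → Unique (cells D)
cells-unique = deduplicate-! _≟ᶜ_

∈-cells⁺ : ∀ {D x} → x ∈ D → x ∈ cells D
∈-cells⁺ = ∈-deduplicate⁺ _≟ᶜ_

∈-cells⁻ : ∀ {D x} → x ∈ cells D → x ∈ D
∈-cells⁻ = ∈-deduplicate⁻ _≟ᶜ_ _

cells-↭ : ∀ {D E} → D ≈ E → cells D ↭ cells E
cells-↭ {D} {E} D≈E = unique-set⇒↭ (cells-unique D) (cells-unique E) λ {x} → mk⇔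
  (λ x∈D → ∈-cells⁺ (proj₁ (D≈E x) (∈-cells⁻ x∈D)))
  (λ x∈E → ∈-cells⁺ (proj₂ (D≈E x) (∈-cells⁻ x∈E)))

unique⇒cells-↭ : ∀ {D} → Unique D → cells D ↭ D
unique⇒cells-↭ {D} uD = unique-set⇒↭ (cells-unique D) uD (mk⇔ ∈-cells⁻ ∈-cells⁺)

≈-refl : ∀ {D} → D ≈ D
≈-refl x = (λ x∈D → x∈D) , (λ x∈D → x∈D)

≈-sym : ∀ {D E} → D ≈ E → E ≈ D
≈-sym D≈E x = proj₂ (D≈E x) , proj₁ (D≈E x)

rowSum : Diagram → ℕ
rowSum D = sum (map proj₁ (cells D))

inColumn? : ∀ c (x : Cell) → Dec (proj₂ x ≡ c)
inColumn? c x = proj₂ x ≟ c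

colSize : Diagram → ℕ → ℕ
colSize D = colCount (cells D)

rowSum-≈ : ∀ {D E} → D ≈ E → rowSum D ≡ rowSum E
rowSum-≈ D≈E = sum-↭ (map⁺ proj₁ (cells-↭ D≈E))

colSize-≈ : ∀ {D E} → D ≈ E → ∀ c → colSize D c ≡ colSize E c
colSize-≈ D≈E c = ↭-length (filter-↭ (inColumn? c) (cells-↭ D≈E))

colSize-unique : ∀ {D} → Unique D → ∀ c → colSize D c ≡ colCount D c
colSize-unique uD c = ↭-length (filter-↭ (inColumn? c) (unique⇒cells-↭ uD))

module _ {D E : Diagram} where

  move-↭ : (mv : KohnertMove D E) → let (r , c , r' , _) = mv in (r' , c) ∷ cells D ↭ (r , c) ∷ cells E
  move-↭ (r , c , r' , rc∈D , _ , _ , r'<r , r'c∉D , _ , spec) =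
    unique-set⇒↭ (All.tabulate (λ { x∈ refl → r'c∉D (∈-cells⁻ x∈) }) ∷ cells-unique D)
                 (All.tabulate (λ { x∈ refl → rc∉E (∈-cells⁻ x∈) }) ∷ cells-unique E)
                 (mk⇔ to from)
    where
    rc∉E : (r , c) ∉ E
    rc∉E rc∈E with proj₁ (spec (r , c)) rc∈E
    ... | inj₁ (_ , rc≢rc) = rc≢rc refl
    ... | inj₂ refl        = <-irrefl refl r'<r
    to : ∀ {x} → x ∈ (r' , c) ∷ cells D → x ∈ (r , c) ∷ cells E
    to (here refl) = there (∈-cells⁺ (proj₂ (spec _) (inj₂ refl)))
    to {x} (there x∈) with x ≟ᶜ (r , c)
    ... | yes refl = here refl
    ... | no x≢rc  = there (∈-cells⁺ (proj₂ (spec x) (inj₁ (∈-cells⁻ x∈ , x≢rc))))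
    from : ∀ {x} → x ∈ (r , c) ∷ cells E → x ∈ (r' , c) ∷ cells D
    from (here refl) = there (∈-cells⁺ rc∈D)
    from {x} (there x∈) with proj₁ (spec x) (∈-cells⁻ x∈)
    ... | inj₁ (x∈D , _) = there (∈-cells⁺ x∈D)
    ... | inj₂ refl      = here refl

  rowSum-move : KohnertMove D E → rowSum E < rowSum D
  rowSum-move mv@(r , c , r' , _ , _ , _ , r'<r , _) = +-cancelˡ-< r (rowSum E) (rowSum D) (begin-strict
    r + rowSum E   ≡⟨ sum-↭ (map⁺ proj₁ (move-↭ mv)) ⟨
    r' + rowSum D  <⟨ +-monoˡ-< (rowSum D) r'<r ⟩
    r + rowSum D   ∎)
    where open ≤-Reasoning

  colSize-move : KohnertMove D E → ∀ i → colSize E i ≡ colSize D i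
  colSize-move mv@(r , c , r' , _) i with c ≟ i
  ... | yes c≡i = suc-injective (begin
    suc (colSize E i)                                   ≡⟨ cong length (filter-accept (inColumn? i) c≡i) ⟨
    length (filter (inColumn? i) ((r , c) ∷ cells E))   ≡⟨ ↭-length (filter-↭ (inColumn? i) (move-↭ mv)) ⟨
    length (filter (inColumn? i) ((r' , c) ∷ cells D))  ≡⟨ cong length (filter-accept (inColumn? i) c≡i) ⟩
    suc (colSize D i)                                   ∎)
    where open ≡-Reasoning
  ... | no c≢i = begin
    colSize E i                                         ≡⟨ cong length (filter-reject (inColumn? i) c≢i) ⟨
    length (filter (inColumn? i) ((r , c) ∷ cells E))   ≡⟨ ↭-length (filter-↭ (inColumn? i) (move-↭ mv)) ⟨
    length (filter (inColumn? i) ((r' , c) ∷ cells D))  ≡⟨ cong length (filter-reject (inColumn? i) c≢i) ⟩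
    colSize D i                                         ∎
    where open ≡-Reasoning

Rightmost : Diagram → ℕ → ℕ → Set
Rightmost D r c = ∀ c' → (r , c') ∈ D → c' ≤ c

FilledBelow : Diagram → ℕ → ℕ → Set
FilledBelow D r c = ∀ r' → 1 ≤ r' → r' < r → (r' , c) ∈ D

HighestGapBelow : Diagram → ℕ → ℕ → ℕ → Set
HighestGapBelow D r c r' = 1 ≤ r' × r' < r × (r' , c) ∉ D × (∀ r'' → r' < r'' → r'' < r → (r'' , c) ∈ D)

Settled : Diagram → Set
Settled D = ∀ r c → (r , c) ∈ D → Rightmost D r c → FilledBelow D r c

rightmost? : ∀ D r c → Dec (Rightmost D r c)
rightmost? D r c = map′
  (λ all c' rc'∈D → All.lookup all rc'∈D refl)
  (λ rightmost → All.tabulate λ { {_ , c'} rc'∈D refl → rightmost c' rc'∈D })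
  (all? (λ x → (proj₁ x ≟ r) →-dec (proj₂ x ≤? c)) D)

<-suc-cases : ∀ {k} (P : ℕ → Set) → (∀ m → m < k → P m) → P k → ∀ m → m < suc k → P m
<-suc-cases {k} P below at m m<1+k with m≤n⇒m<n∨m≡n (s≤s⁻¹ m<1+k)
... | inj₁ m<k  = below m m<k
... | inj₂ refl = at

filled-or-gap : ∀ D r c → FilledBelow D r c ⊎ ∃[ r' ] HighestGapBelow D r c r'
filled-or-gap D zero          c = inj₁ λ _ _ ()
filled-or-gap D (suc zero)    c = inj₁ λ { _ 1≤r' r'<1 → contradiction 1≤r' (<⇒≱ r'<1) }
filled-or-gap D (suc (suc k)) c with (suc k , c) ∈? D | filled-or-gap D (suc k) c
... | no gap    | _ = inj₂ (suc k , s≤s z≤n , ≤-refl , gap , λ _ k<r'' r''<k → contradiction k<r'' (<⇒≱ r''<k))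
... | yes top∈D | inj₁ filled = inj₁ λ r'' 1≤r'' r''<r →
  <-suc-cases (λ m → 1 ≤ m → (m , c) ∈ D) (λ m m<k 1≤m → filled m 1≤m m<k) (λ _ → top∈D) r'' r''<r 1≤r''
... | yes top∈D | inj₂ (r' , 1≤r' , r'<k , gap , between) =
  inj₂ (r' , 1≤r' , m<n⇒m<1+n r'<k , gap , λ r'' r'<r'' r''<r →
  <-suc-cases (λ m → r' < m → (m , c) ∈ D) (λ m m<k r'<m → between m r'<m m<k) (λ _ → top∈D) r'' r''<r r'<r'')

move-down : ∀ {D r c r'} → (r , c) ∈ D → Rightmost D r c → HighestGapBelow D r c r' → Σ Diagram (KohnertMove D)
move-down {D} {r} {c} {r'} rc∈D rightmost (1≤r' , r'<r , gap , between) =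
  (r' , c) ∷ filter others? D , r , c , r' , rc∈D , rightmost , 1≤r' , r'<r , gap , between , λ x → to , from
  where
  others? : (x : Cell) → Dec (x ≢ (r , c))
  others? x = ¬? (x ≟ᶜ (r , c))
  to : ∀ {x} → x ∈ (r' , c) ∷ filter others? D → (x ∈ D × x ≢ (r , c)) ⊎ x ≡ (r' , c)
  to (here x≡r'c) = inj₂ x≡r'c
  to (there x∈)   = inj₁ (∈-filter⁻ others? x∈)
  from : ∀ {x} → (x ∈ D × x ≢ (r , c)) ⊎ x ≡ (r' , c) → x ∈ (r' , c) ∷ filter others? D
  from (inj₁ (x∈D , x≢rc)) = there (∈-filter⁺ others? x∈D x≢rc)
  from (inj₂ x≡r'c)        = here x≡r'c

Movable : Diagram → Cell → Set
Movable D (r , c) = Rightmost D r c × ∃[ r' ] HighestGapBelow D r c r'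

movable? : ∀ D x → Dec (Movable D x)
movable? D (r , c) with rightmost? D r c | filled-or-gap D r c
... | no ¬rightmost | _          = no λ (rightmost , _) → ¬rightmost rightmost
... | yes rightmost | inj₂ gap   = yes (rightmost , gap)
... | yes _         | inj₁ filled = no λ (_ , r' , 1≤r' , r'<r , gap , _) → gap (filled r' 1≤r' r'<r)

settled-or-move : ∀ D → Settled D ⊎ Σ Diagram (KohnertMove D)
settled-or-move D with any? (movable? D) D
... | yes some = let (r , c) , rc∈D , rightmost , _ , gap = find some in inj₂ (move-down rc∈D rightmost gap)
... | no none  = inj₁ settled
  where
  settled : Settled D
  settled r c rc∈D rightmost with filled-or-gap D r c
  ... | inj₁ filled = filled
  ... | inj₂ gap    = contradiction (lose rc∈D (rightmost , gap)) none

settled⇒¬move : ∀ {D E} → Settled D → ¬ KohnertMove D E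
settled⇒¬move settled (r , c , r' , rc∈D , rightmost , 1≤r' , r'<r , gap , _) =
  gap (settled r c rc∈D rightmost r' 1≤r' r'<r)

move-respˡ-≈ : ∀ {D D' E} → D ≈ D' → KohnertMove D E → KohnertMove D' E
move-respˡ-≈ {D} {D'} D≈D' (r , c , r' , rc∈D , rightmost , 1≤r' , r'<r , gap , between , spec) =
  r , c , r' , to rc∈D , (λ c' rc'∈D' → rightmost c' (from rc'∈D')) , 1≤r' , r'<r ,
  (λ r'c∈D' → gap (from r'c∈D')) , (λ r'' r'<r'' r''<r → to (between r'' r'<r'' r''<r)) ,
  λ x → Sum.map₁ (Product.map₁ to) ∘ proj₁ (spec x) , proj₂ (spec x) ∘ Sum.map₁ (Product.map₁ from)
  where
  to : ∀ {x} → x ∈ D → x ∈ D'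
  to {x} = proj₁ (D≈D' x)
  from : ∀ {x} → x ∈ D' → x ∈ D
  from {x} = proj₂ (D≈D' x)

rowSum-moves : ∀ {D E} → Star KohnertMove D E → rowSum E ≤ rowSum D
rowSum-moves ε          = ≤-refl
rowSum-moves (mv ◅ mvs) = ≤-trans (rowSum-moves mvs) (<⇒≤ (rowSum-move mv))

mutually-reachable⇒≈ : ∀ {D E} → Reach D E → Reach E D → E ≈ D
mutually-reachable⇒≈ (_ , ε , D≈E) _ = ≈-sym D≈E
mutually-reachable⇒≈ {D} {E} (D' , mv ◅ mvs , D'≈E) (E' , mvs' , E'≈D) = contradiction (begin-strict
  rowSum D   ≡⟨ rowSum-≈ E'≈D ⟨
  rowSum E'  ≤⟨ rowSum-moves mvs' ⟩
  rowSum E   ≡⟨ rowSum-≈ D'≈E ⟨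
  rowSum D'  ≤⟨ rowSum-moves mvs ⟩
  _          <⟨ rowSum-move mv ⟩
  rowSum D   ∎) (<-irrefl refl)
  where open ≤-Reasoning

settled-reach⇒≈ : ∀ {D E} → Settled D → Reach D E → E ≈ D
settled-reach⇒≈ _       (_ , ε , D≈E)       = ≈-sym D≈E
settled-reach⇒≈ settled (_ , mv ◅ _ , _) = contradiction mv (settled⇒¬move settled)

settle : ∀ D → Σ Diagram λ S → Star KohnertMove D S × Settled S
settle D = go D (<-wellFounded (rowSum D))
  where
  go : ∀ D → Acc _<_ (rowSum D) → Σ Diagram λ S → Star KohnertMove D S × Settled S
  go D (acc smaller) with settled-or-move D
  ... | inj₁ settled  = D , ε , settled
  ... | inj₂ (E , mv) = let S , mvs , settled = go E (smaller (rowSum-move mv)) in S , mv ◅ mvs , settled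

rightmost-in-row : ∀ {D r c} → (r , c) ∈ D → ∃[ c* ] c ≤ c* × (r , c*) ∈ D × Rightmost D r c*
rightmost-in-row {D} {r} {c} rc∈D =
  proj₂ rightmost , f[⊥]≤f[argmax] {f = proj₂} (r , c) row , rightmost∈D ,
  λ c' rc'∈D → All.lookup (f[xs]≤f[argmax] (r , c) row) (∈-filter⁺ inRow? rc'∈D refl)
  where
  inRow? : (x : Cell) → Dec (proj₁ x ≡ r)
  inRow? x = proj₁ x ≟ r
  row : List Cell
  row = filter inRow? D
  rightmost : Cell
  rightmost = argmax proj₂ (r , c) row
  rightmost∈D : (r , proj₂ rightmost) ∈ D
  rightmost∈D with argmax-sel proj₂ (r , c) row
  ... | inj₁ rightmost≡rc = subst (λ x → (r , proj₂ x) ∈ D) (sym rightmost≡rc) rc∈D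
  ... | inj₂ rightmost∈row = let rightmost∈D , inRow = ∈-filter⁻ inRow? rightmost∈row in
    subst (λ r' → (r' , proj₂ rightmost) ∈ D) inRow rightmost∈D

column : ℕ → ℕ → List Cell
column c k = applyUpTo (λ i → suc i , c) k

column-unique : ∀ c k → Unique (column c k)
column-unique c k = applyUpTo⁺₁ _ k λ i<j _ same → <-irrefl (suc-injective (cong proj₁ same)) i<j

length-column : ∀ c k → length (column c k) ≡ k
length-column c = length-applyUpTo _

∈-column⁺ : ∀ {r c k} → 1 ≤ r → r ≤ k → (r , c) ∈ column c k
∈-column⁺ {suc i} _ r≤k = ∈-applyUpTo⁺ _ r≤k

InBox : ℕ → Diagram → Set
InBox n D = ∀ r c → (r , c) ∈ D → (1 ≤ r) × (1 ≤ c) × (c ≤ n)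

NonIncreasingOn : ℕ → (ℕ → ℕ) → Set
NonIncreasingOn n b = ∀ i → 1 ≤ i → i < n → b (suc i) ≤ b i

antitone : ∀ {n b c c'} → NonIncreasingOn n b → 1 ≤ c → c ≤′ c' → c' ≤ n → b c' ≤ b c
antitone _ _ ≤′-refl _ = ≤-refl
antitone {c' = suc c'} step 1≤c (≤′-step c≤′c') c'<n =
  ≤-trans (step c' (≤-trans 1≤c (≤′⇒≤ c≤′c')) c'<n) (antitone step 1≤c c≤′c' (<⇒≤ c'<n))

module BottomJustified {n b} (decreasing : NonIncreasingOn n b) {D} (inBox : InBox n D)
                       (sizes : ∀ c → colSize D c ≡ b c) (settled : Settled D) where

  -- The rightmost cell (r , c*) of row r sits on a full column c*, which therefore
  -- has at least r cells.
  row≤size : ∀ {r c} → (r , c) ∈ D → r ≤ b c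
  row≤size {r} {c} rc∈D with rightmost-in-row rc∈D
  ... | c* , c≤c* , rc*∈D , rightmost = begin
    r                                         ≡⟨ length-column c* r ⟨
    length (column c* r)                      ≤⟨ length-≤-⊆ _≟ᶜ_ (column-unique c* r) column⊆D ⟩
    length (filter (inColumn? c*) (cells D))  ≡⟨ sizes c* ⟩
    b c*                                      ≤⟨ antitone decreasing 1≤c (≤⇒≤′ c≤c*) c*≤n ⟩
    b c                                       ∎
    where
    open ≤-Reasoning
    1≤c : 1 ≤ c
    1≤c = proj₁ (proj₂ (inBox r c rc∈D))
    c*≤n : c* ≤ n
    c*≤n = proj₂ (proj₂ (inBox r c* rc*∈D))
    column⊆D : column c* r ⊆ filter (inColumn? c*) (cells D)
    column⊆D x∈column with ∈-applyUpTo⁻ _ x∈column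
    ... | i , i<r , refl = ∈-filter⁺ (inColumn? c*) (∈-cells⁺ below) refl
      where
      below : (suc i , c*) ∈ D
      below with m≤n⇒m<n∨m≡n i<r
      ... | inj₁ 1+i<r = settled r c* rc*∈D rightmost (suc i) (s≤s z≤n) 1+i<r
      ... | inj₂ refl  = rc*∈D

  ∈⇔bottom-justified : ∀ r c → (r , c) ∈ D ⇔ (1 ≤ r × r ≤ b c)
  ∈⇔bottom-justified r c = mk⇔ (λ rc∈D → proj₁ (inBox r c rc∈D) , row≤size rc∈D) filled
    where
    column-cells⊆column : filter (inColumn? c) (cells D) ⊆ column c (b c)
    column-cells⊆column {r' , c'} x∈ with ∈-filter⁻ (inColumn? c) x∈
    ... | x∈cells , refl = let x∈D = ∈-cells⁻ x∈cells in ∈-column⁺ (proj₁ (inBox r' c' x∈D)) (row≤size x∈D)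
    -- Column c lies within rows 1, …, b c and has b c cells, so it leaves no gap there.
    filled : 1 ≤ r × r ≤ b c → (r , c) ∈ D
    filled (1≤r , r≤bc) with (r , c) ∈? D
    ... | yes rc∈D = rc∈D
    ... | no rc∉D  = contradiction (begin-strict
      b c                                      ≡⟨ sizes c ⟨
      length (filter (inColumn? c) (cells D))  <⟨ length-<-⊆ _≟ᶜ_ (filter⁺ (inColumn? c) (cells-unique D))
                                                     column-cells⊆column (∈-column⁺ 1≤r r≤bc)
                                                     (rc∉D ∘ ∈-cells⁻ ∘ proj₁ ∘ ∈-filter⁻ (inColumn? c)) ⟩
      length (column c (b c))                  ≡⟨ length-column c (b c) ⟩
      b c                                      ∎) (<-irrefl refl)
      where open ≤-Reasoning

HasColumns : ℕ → (ℕ → ℕ) → Diagram → Set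
HasColumns n b D = InBox n D × (∀ c → colSize D c ≡ b c)

settled-unique : ∀ {n b D E} → NonIncreasingOn n b →
                 HasColumns n b D → Settled D → HasColumns n b E → Settled E → D ≈ E
settled-unique {b = b} {D} {E} decreasing (boxD , sizesD) settledD (boxE , sizesE) settledE (r , c) =
  Equivalence.from E-shape ∘ Equivalence.to D-shape , Equivalence.from D-shape ∘ Equivalence.to E-shape
  where
  D-shape : (r , c) ∈ D ⇔ (1 ≤ r × r ≤ b c)
  E-shape : (r , c) ∈ E ⇔ (1 ≤ r × r ≤ b c)
  D-shape = BottomJustified.∈⇔bottom-justified decreasing boxD sizesD settledD r c
  E-shape = BottomJustified.∈⇔bottom-justified decreasing boxE sizesE settledE r c

hasColumns-≈ : ∀ {n b D E} → D ≈ E → HasColumns n b D → HasColumns n b E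
hasColumns-≈ D≈E (box , sizes) =
  (λ r c rc∈E → box r c (proj₂ (D≈E (r , c)) rc∈E)) , λ c → trans (sym (colSize-≈ D≈E c)) (sizes c)

hasColumns-move : ∀ {n b D E} → KohnertMove D E → HasColumns n b D → HasColumns n b E
hasColumns-move {n} {E = E} mv@(r , c , r' , rc∈D , _ , 1≤r' , _ , _ , _ , spec) (box , sizes) =
  boxE , λ i → trans (colSize-move mv i) (sizes i)
  where
  boxE : InBox n E
  boxE r'' c'' x∈E with proj₁ (spec (r'' , c'')) x∈E
  ... | inj₁ (x∈D , _) = box r'' c'' x∈D
  ... | inj₂ refl      = 1≤r' , proj₂ (box r c rc∈D)

hasColumns-reach : ∀ {n b D E} → Reach D E → HasColumns n b D → HasColumns n b E
hasColumns-reach (_ , mvs , D'≈E) = hasColumns-≈ D'≈E ∘ along mvs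
  where
  along : ∀ {n b D D'} → Star KohnertMove D D' → HasColumns n b D → HasColumns n b D'
  along ε          = λ shape → shape
  along (mv ◅ mvs) = along mvs ∘ hasColumns-move mv

reach-refl : ∀ {D} → Reach D D
reach-refl = _ , ε , ≈-refl

maximum : ∀ D₀ → Σ Diagram λ M → IsMaximal D₀ M × (∀ M' → IsMaximal D₀ M' → M' ≈ M)
maximum D₀ = D₀ , (reach-refl , λ D D₀→D D→D₀ → mutually-reachable⇒≈ D₀→D D→D₀) ,
  λ M' (D₀→M' , maximal) → ≈-sym (maximal D₀ reach-refl D₀→M')

settled⇒minimal : ∀ {D₀ S} → Reach D₀ S → Settled S → IsMinimal D₀ S
settled⇒minimal D₀→S settled = D₀→S , λ D _ S→D → settled-reach⇒≈ settled S→D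

minimal⇒settled : ∀ {D₀ M} → IsMinimal D₀ M → Settled M
minimal⇒settled {M = M} ((M' , D₀→M' , M'≈M) , minimal) with settled-or-move M
... | inj₁ settled  = settled
... | inj₂ (E , mv) = contradiction (rowSum-≈ E≈M) (<⇒≢ (rowSum-move mv))
  where
  E≈M : E ≈ M
  E≈M = minimal E (E , D₀→M' ◅◅ (move-respˡ-≈ (≈-sym M'≈M) mv ◅ ε) , ≈-refl) (E , mv ◅ ε , ≈-refl)

minimum : ∀ {n b D₀} → NonIncreasingOn n b → HasColumns n b D₀ →
          Σ Diagram λ m → IsMinimal D₀ m × (∀ m' → IsMinimal D₀ m' → m' ≈ m)
minimum {D₀ = D₀} decreasing shape₀ with settle D₀
... | S , moves , settled = S , settled⇒minimal D₀→S settled , λ m' minimal →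
  settled-unique decreasing (hasColumns-reach (proj₁ minimal) shape₀) (minimal⇒settled minimal)
                            (hasColumns-reach D₀→S shape₀) settled
  where
  D₀→S : Reach D₀ S
  D₀→S = S , moves , ≈-refl

proposition3p2 : (n : ℕ) (D₀ : Diagram) → Unique D₀
    → (∀ r c → (r , c) ∈ D₀ → (1 ≤ r) × (1 ≤ c) × (c ≤ n))
    → (∀ i → 1 ≤ i → i < n → colCount D₀ (suc i) ≤ colCount D₀ i)
    → Bounded D₀
proposition3p2 n D₀ u₀ box₀ decreasing = minimum decreasing (box₀ , colSize-unique u₀) , maximum D₀
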